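{- Let $s,t$ be positive integers, let $(A_1,\dots,A_m)$ be the associated partition of an $(s,t)$-spike $M$, and let $(J,K)$ be a partition of $\{1,\dots,m\}$ with $|J|\le|K|$. Write $A_J=\bigcup_{j\in J}A_j$. Then: (i) if $|J|\le t-1$, then $\lambda(A_J)=r(A_J)$; (ii) if $t-1\le|J|\le m-s$, then $\lambda(A_J)=t+|J|-1$ when $|J|<s$, and $\lambda(A_J)=s+t-2$ when $s\le|J|\le m-t+1$; (iii) if $|J|>m-s$, then $\lambda(A_J)=m-s+t$.
   Context: For positive integers $s,t$, an $(s,t)$-spike of order $m$ is a matroid $M$ with $m\ge\max\{s,t\}$ together with an associated partition $(A_1,\dots,A_m)$ of $E(M)$ into $2$-element sets (arms) such that the union of any $s$ arms is a circuit of $M$ and the union of any $t$ arms is a cocircuit of $M$. The connectivity function of $M$ is $\lambda(X)=r(X)+r(E(M)-X)-r(M)$ for $X\subseteq E(M)$. -}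

module Defs where

open import Data.Nat using (ℕ; zero; suc; _+_; _∸_; _⊔_; _<_; _≤_)
open import Data.Bool using (Bool; true; false; _∧_)
open import Data.Fin using (Fin)
open import Data.Fin.Subset using (Subset; _∈_; _∉_; _⊆_; _⊂_; _∪_; ⁅_⁆; ∁; ∣_∣; ⊤; inside; outside)
  renaming (⊥ to ∅)
open import Data.Fin.Subset.Properties using (_⊆?_)
open import Data.List using (List; []; _∷_; _++_; map; foldr)
open import Data.Vec using (Vec; []; _∷_; tabulate; lookup)
open import Data.Product using (Σ; _×_; ∃-syntax)
open import Relation.Nullary using (⌊_⌋)
open import Relation.Binary.PropositionalEquality using (_≡_)

record Matroid (n : ℕ) : Set where
  field
    indep     : Subset n → Bool
    indep-∅   : indep ∅ ≡ true
    indep-⊆   : ∀ {X Y} → Y ⊆ X → indep X ≡ true → indep Y ≡ true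
    indep-aug : ∀ {I J} → indep I ≡ true → indep J ≡ true → ∣ I ∣ < ∣ J ∣ →
                ∃[ e ] (e ∈ J × e ∉ I × indep (I ∪ ⁅ e ⁆) ≡ true)

open Matroid public

allSubsets : (n : ℕ) → List (Subset n)
allSubsets zero    = [] ∷ []
allSubsets (suc n) = map (outside ∷_) (allSubsets n) ++ map (inside ∷_) (allSubsets n)

rank : ∀ {n} → Matroid n → Subset n → ℕ
rank {n} M X = foldr (λ Y acc → if' (⌊ Y ⊆? X ⌋ ∧ indep M Y) ∣ Y ∣ acc) 0 (allSubsets n)
  where
  if' : Bool → ℕ → ℕ → ℕ
  if' true  k acc = k ⊔ acc
  if' false k acc = acc

conn : ∀ {n} → Matroid n → Subset n → ℕ
conn M X = rank M X + rank M (∁ X) ∸ rank M ⊤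

IsCircuit : ∀ {n} → Matroid n → Subset n → Set
IsCircuit M C = (indep M C ≡ false) × (∀ Y → Y ⊂ C → indep M Y ≡ true)

-- C is a cocircuit: a circuit of the dual matroid M*, whose independent
-- sets are the I with r(E - I) = r(M).
IsCocircuit : ∀ {n} → Matroid n → Subset n → Set
IsCocircuit M C = (rank M (∁ C) < rank M ⊤) × (∀ Y → Y ⊂ C → rank M (∁ Y) ≡ rank M ⊤)

armUnion : ∀ {n m} → (Fin n → Fin m) → Subset m → Subset n
armUnion arm J = tabulate (λ e → lookup J (arm e))

-- (s,t)-spike of order m: M on Fin n with partition into arms A_1..A_m
-- given by arm : Fin n → Fin m, each arm of size 2.
record IsSpike (s t m : ℕ) {n : ℕ} (M : Matroid n) (arm : Fin n → Fin m) : Set where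
  field
    s≤m      : s ≤ m
    t≤m      : t ≤ m
    arm-size : ∀ i → ∣ armUnion arm ⁅ i ⁆ ∣ ≡ 2
    circuits   : ∀ (J : Subset m) → ∣ J ∣ ≡ s → IsCircuit M (armUnion arm J)
    cocircuits : ∀ (J : Subset m) → ∣ J ∣ ≡ t → IsCocircuit M (armUnion arm J)

module Submission where

-- Write s = s′ + 1, t = t′ + 1 and A_J for the union of the arms in J. At most s′ arms lie properly
-- inside an s-arm circuit, so they are independent: r(A_J) = 2|J|; dually, the complement of at
-- most t′ arms is spanning. In between, each further arm raises the rank by exactly one: by at most
-- one, since together with s′ arms already present it forms a circuit, which puts one of its
-- elements in the closure of the rest; by at least one, since when t′ arms are still missing it lies
-- on a t-arm cocircuit avoiding the arms present, which keeps its elements out of their closure.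
-- Hence r(A_J) = |J| + s′ for s′ ≤ |J| ≤ m − t′. If m ≤ s′ + t′, then s arms and s′ of them would
-- both be spanning although their ranks 2s′ + 1 and 2s′ differ; so s′ + t′ < m and r(M) = m − t′ + s′,
-- and the values of λ(A_J) = r(A_J) + r(A_K) − r(M) follow by arithmetic.

open import Defs
open import Data.Nat using (ℕ; zero; suc; _+_; _*_; _∸_; _⊔_; _≤_; _<_; z≤n; s≤s; s≤s⁻¹)
open import Data.Nat.Properties
open import Data.Nat.Tactic.RingSolver using (solve-∀)
open import Data.Bool using (Bool; true; false; not; _∧_; if_then_else_)
open import Data.Bool.Properties using (not-involutive)
open import Data.Fin using (Fin; zero; suc) renaming (_≟_ to _≟ᶠ_)
open import Data.Fin.Subset
  using (Subset; inside; outside; _∈_; _∉_; _⊆_; _⊂_; _∪_; _─_; _-_; ⁅_⁆; ∁; ∣_∣; ⊤; Nonempty)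
  renaming (⊥ to ∅)
open import Data.Fin.Subset.Properties
open import Data.List using ([]; _∷_; map; foldr)
import Data.List.Membership.Propositional as List
open import Data.List.Membership.Propositional.Properties using (∈-map⁺; ∈-++⁺ˡ; ∈-++⁺ʳ)
open import Data.List.Relation.Unary.Any using (here; there)
open import Data.Vec using (_∷_; []; here; there; lookup)
open import Data.Vec.Properties
  using (lookup⇒[]=; []=⇒lookup; lookup∘tabulate; lookup-map; tabulate-cong; tabulate-∘)
open import Data.Product using (Σ; _×_; _,_; proj₁; proj₂; ∃-syntax)
open import Data.Sum using (_⊎_; inj₁; inj₂; [_,_]′)
open import Data.Empty using (⊥-elim)
open import Relation.Nullary using (¬_; yes; no; contradiction; ⌊_⌋)
open import Relation.Nullary.Decidable using (dec-true; isYes≗does)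
open import Relation.Binary.PropositionalEquality
open import Function using (_∘_; id)

private
  variable
    k n : ℕ
    p q r : Subset n
    x y : Fin n

∣p∪q∣≡∣p∣+∣q∣ : (p q : Subset n) → (∀ {x} → x ∈ p → x ∉ q) → ∣ p ∪ q ∣ ≡ ∣ p ∣ + ∣ q ∣
∣p∪q∣≡∣p∣+∣q∣ []            []            _ = refl
∣p∪q∣≡∣p∣+∣q∣ (inside  ∷ p) (inside  ∷ q) d = ⊥-elim (d here here)
∣p∪q∣≡∣p∣+∣q∣ (inside  ∷ p) (outside ∷ q) d =
  cong suc (∣p∪q∣≡∣p∣+∣q∣ p q (λ x∈p x∈q → d (there x∈p) (there x∈q)))
∣p∪q∣≡∣p∣+∣q∣ (outside ∷ p) (inside  ∷ q) d =
  trans (cong suc (∣p∪q∣≡∣p∣+∣q∣ p q (λ x∈p x∈q → d (there x∈p) (there x∈q)))) (sym (+-suc _ _))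
∣p∪q∣≡∣p∣+∣q∣ (outside ∷ p) (outside ∷ q) d =
  ∣p∪q∣≡∣p∣+∣q∣ p q (λ x∈p x∈q → d (there x∈p) (there x∈q))

x∉p⇒∣p∪⁅x⁆∣≡1+∣p∣ : x ∉ p → ∣ p ∪ ⁅ x ⁆ ∣ ≡ suc ∣ p ∣
x∉p⇒∣p∪⁅x⁆∣≡1+∣p∣ {x = x} {p = p} x∉p = begin
  ∣ p ∪ ⁅ x ⁆ ∣      ≡⟨ ∣p∪q∣≡∣p∣+∣q∣ p ⁅ x ⁆ (λ y∈p y∈⁅x⁆ → x∉p (subst (_∈ p) (x∈⁅y⁆⇒x≡y x y∈⁅x⁆) y∈p)) ⟩
  ∣ p ∣ + ∣ ⁅ x ⁆ ∣  ≡⟨ cong (∣ p ∣ +_) (∣⁅x⁆∣≡1 x) ⟩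
  ∣ p ∣ + 1          ≡⟨ +-comm ∣ p ∣ 1 ⟩
  suc ∣ p ∣          ∎
  where open ≡-Reasoning

x∈p⇒∣p-x∣+1≡∣p∣ : x ∈ p → suc ∣ p - x ∣ ≡ ∣ p ∣
x∈p⇒∣p-x∣+1≡∣p∣ {p = inside  ∷ p} here        = cong (suc ∘ ∣_∣) (p─⊥≡p p)
x∈p⇒∣p-x∣+1≡∣p∣ {p = inside  ∷ p} (there x∈p) = cong suc (x∈p⇒∣p-x∣+1≡∣p∣ x∈p)
x∈p⇒∣p-x∣+1≡∣p∣ {p = outside ∷ p} (there x∈p) = x∈p⇒∣p-x∣+1≡∣p∣ x∈p

∣p∣≤∣p─q∣+∣q∣ : (p q : Subset n) → ∣ p ∣ ≤ ∣ p ─ q ∣ + ∣ q ∣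
∣p∣≤∣p─q∣+∣q∣ []            []            = z≤n
∣p∣≤∣p─q∣+∣q∣ (inside  ∷ p) (inside  ∷ q) = ≤-trans (s≤s (∣p∣≤∣p─q∣+∣q∣ p q)) (≤-reflexive (sym (+-suc _ _)))
∣p∣≤∣p─q∣+∣q∣ (inside  ∷ p) (outside ∷ q) = s≤s (∣p∣≤∣p─q∣+∣q∣ p q)
∣p∣≤∣p─q∣+∣q∣ (outside ∷ p) (inside  ∷ q) = ≤-trans (∣p∣≤∣p─q∣+∣q∣ p q) (+-monoʳ-≤ ∣ p ─ q ∣ (n≤1+n ∣ q ∣))
∣p∣≤∣p─q∣+∣q∣ (outside ∷ p) (outside ∷ q) = ∣p∣≤∣p─q∣+∣q∣ p q

Nonempty⇒0<∣p∣ : Nonempty p → 0 < ∣ p ∣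
Nonempty⇒0<∣p∣ {p = p} (x , x∈p) =
  ≤-trans (≤-reflexive (sym (∣⁅x⁆∣≡1 x))) (p⊆q⇒∣p∣≤∣q∣ (λ y∈⁅x⁆ → subst (_∈ p) (sym (x∈⁅y⁆⇒x≡y x y∈⁅x⁆)) x∈p))

∣p∣≡1+k⇒Nonempty : ∀ p → ∣ p ∣ ≡ suc k → Nonempty {n} p
∣p∣≡1+k⇒Nonempty (inside  ∷ p) _ = zero , here
∣p∣≡1+k⇒Nonempty (outside ∷ p) ∣p∣≡1+k with x , x∈p ← ∣p∣≡1+k⇒Nonempty p ∣p∣≡1+k = suc x , there x∈p

∣p∣≡1+k⇒∣p-x∣≡k : x ∈ p → ∣ p ∣ ≡ suc k → ∣ p - x ∣ ≡ k
∣p∣≡1+k⇒∣p-x∣≡k x∈p ∣p∣≡1+k = suc-injective (trans (x∈p⇒∣p-x∣+1≡∣p∣ x∈p) ∣p∣≡1+k)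

x∈p─q⇒x∉q : x ∈ p ─ q → x ∉ q
x∈p─q⇒x∉q {p = _ ∷ _} {q = inside  ∷ _} (there x∈p─q) (there x∈q) = x∈p─q⇒x∉q x∈p─q x∈q
x∈p─q⇒x∉q {p = _ ∷ _} {q = outside ∷ _} (there x∈p─q) (there x∈q) = x∈p─q⇒x∉q x∈p─q x∈q

x∉p-x : x ∉ p - x
x∉p-x {x = x} x∈p-x = x∈p─q⇒x∉q x∈p-x (x∈⁅x⁆ x)

p⊆r∧x∈r⇒p∪⁅x⁆⊆r : p ⊆ r → x ∈ r → p ∪ ⁅ x ⁆ ⊆ r
p⊆r∧x∈r⇒p∪⁅x⁆⊆r {p = p} {x = x} p⊆r x∈r y∈p∪⁅x⁆ =
  [ p⊆r , (λ y∈⁅x⁆ → subst (_∈ _) (sym (x∈⁅y⁆⇒x≡y x y∈⁅x⁆)) x∈r) ]′ (x∈p∪q⁻ p ⁅ x ⁆ y∈p∪⁅x⁆)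

p⊆p-x∪⁅x⁆ : ∀ x → p ⊆ (p - x) ∪ ⁅ x ⁆
p⊆p-x∪⁅x⁆ {p = p} x {y} y∈p with y ≟ᶠ x
... | yes refl = q⊆p∪q (p - x) ⁅ x ⁆ (x∈⁅x⁆ x)
... | no  y≢x  = p⊆p∪q ⁅ x ⁆ (x∈p∧x≢y⇒x∈p-y y∈p y≢x)

∁[p-x]⊆∁p∪⁅x⁆ : ∀ x → ∁ (p - x) ⊆ ∁ p ∪ ⁅ x ⁆
∁[p-x]⊆∁p∪⁅x⁆ {p = p} x {y} y∈∁[p-x] with y ≟ᶠ x
... | yes refl = q⊆p∪q (∁ p) ⁅ x ⁆ (x∈⁅x⁆ x)
... | no  y≢x  = p⊆p∪q ⁅ x ⁆ (x∉p⇒x∈∁p (λ y∈p → x∈∁p⇒x∉p y∈∁[p-x] (x∈p∧x≢y⇒x∈p-y y∈p y≢x)))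

p⊆q⇒p-x⊆q-x : p ⊆ q → p - x ⊆ q - x
p⊆q⇒p-x⊆q-x {p = p} {x = x} p⊆q y∈p-x = x∈p∧x∉q⇒x∈p─q (p⊆q (p─q⊆p p ⁅ x ⁆ y∈p-x)) (x∈p─q⇒x∉q y∈p-x)

∁-involutive : (p : Subset n) → ∁ (∁ p) ≡ p
∁-involutive []      = refl
∁-involutive (x ∷ p) = cong₂ _∷_ (not-involutive x) (∁-involutive p)

p⊆q∧p⊄q⇒q⊆p : p ⊆ q → ¬ p ⊂ q → q ⊆ p
p⊆q∧p⊄q⇒q⊆p {p = p} p⊆q p⊄q {x} x∈q with x ∈? p
... | yes x∈p = x∈p
... | no  x∉p = contradiction ((λ {y} → p⊆q {y}) , x , x∈q , x∉p) p⊄q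

p⊆q∧∣p∣<∣q∣⇒p⊂q : p ⊆ q → ∣ p ∣ < ∣ q ∣ → p ⊂ q
p⊆q∧∣p∣<∣q∣⇒p⊂q {p = p} {q = q} p⊆q ∣p∣<∣q∣ with p ⊂? q
... | yes p⊂q = p⊂q
... | no  p⊄q = contradiction (p⊆q⇒∣p∣≤∣q∣ (p⊆q∧p⊄q⇒q⊆p p⊆q p⊄q)) (<⇒≱ ∣p∣<∣q∣)

subset-of-size : (p : Subset n) → k ≤ ∣ p ∣ → ∃[ q ] (q ⊆ p × ∣ q ∣ ≡ k)
subset-of-size {n = n} {k = zero} _ _ = ∅ , ⊥⊆ , ∣⊥∣≡0 n
subset-of-size {k = suc k} (outside ∷ p) 1+k≤∣p∣ with q , q⊆p , ∣q∣≡1+k ← subset-of-size p 1+k≤∣p∣ =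
  outside ∷ q , out⊆ q⊆p , ∣q∣≡1+k
subset-of-size {k = suc k} (inside  ∷ p) (s≤s k≤∣p∣) with q , q⊆p , ∣q∣≡k ← subset-of-size p k≤∣p∣ =
  inside ∷ q , s⊆s q⊆p , cong suc ∣q∣≡k

superset-of-size : (p : Subset n) → ∣ p ∣ ≤ k → k ≤ n → ∃[ q ] (p ⊆ q × ∣ q ∣ ≡ k)
superset-of-size {n = n} {k = k} p ∣p∣≤k k≤n
  with subset-of-size (∁ p) (subst (n ∸ k ≤_) (sym (∣∁p∣≡n∸∣p∣ p)) (∸-monoʳ-≤ n ∣p∣≤k))
... | q , q⊆∁p , ∣q∣≡n∸k =
  ∁ q , (λ x∈p → x∉p⇒x∈∁p (λ x∈q → x∈p⇒x∉∁p x∈p (q⊆∁p x∈q))) ,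
  trans (∣∁p∣≡n∸∣p∣ q) (trans (cong (n ∸_) ∣q∣≡n∸k) (m∸[m∸n]≡n k≤n))

proper-superset-of-size : (p : Subset n) → ∣ p ∣ < k → k ≤ n → ∃[ q ] (p ⊂ q × ∣ q ∣ ≡ k)
proper-superset-of-size p ∣p∣<k k≤n with q , p⊆q , ∣q∣≡k ← superset-of-size p (<⇒≤ ∣p∣<k) k≤n =
  q , p⊆q∧∣p∣<∣q∣⇒p⊂q p⊆q (subst (∣ p ∣ <_) (sym ∣q∣≡k) ∣p∣<k) , ∣q∣≡k

j≤m∸[1+n]+1⇒j+n≤m : ∀ {j n m} → suc n ≤ m → j ≤ m ∸ suc n + 1 → j + n ≤ m
j≤m∸[1+n]+1⇒j+n≤m {j} {n} {m} 1+n≤m j≤ = begin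
  j + n                  ≤⟨ +-monoˡ-≤ n j≤ ⟩
  m ∸ suc n + 1 + n      ≡⟨ +-assoc (m ∸ suc n) 1 n ⟩
  m ∸ suc n + suc n      ≡⟨ m∸n+n≡m 1+n≤m ⟩
  m                      ∎
  where open ≤-Reasoning

m∸[1+n]<o⇒m≤o+n : ∀ {m n o} → suc n ≤ m → m ∸ suc n < o → m ≤ o + n
m∸[1+n]<o⇒m≤o+n {m} {n} {o} 1+n≤m m∸[1+n]<o = begin
  m                      ≡⟨ m∸n+n≡m 1+n≤m ⟨
  m ∸ suc n + suc n      ≡⟨ +-suc (m ∸ suc n) n ⟩
  suc (m ∸ suc n) + n    ≤⟨ +-monoˡ-≤ n m∸[1+n]<o ⟩
  o + n                  ∎
  where open ≤-Reasoning

∣p∣+∣∁p∣≡n : (p : Subset n) → ∣ p ∣ + ∣ ∁ p ∣ ≡ n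
∣p∣+∣∁p∣≡n p = trans (cong (∣ p ∣ +_) (∣∁p∣≡n∸∣p∣ p)) (m+[n∸m]≡n (∣p∣≤n p))

∣p∣+k≤n⇒k≤∣∁p∣ : (p : Subset n) → ∣ p ∣ + k ≤ n → k ≤ ∣ ∁ p ∣
∣p∣+k≤n⇒k≤∣∁p∣ p h = +-cancelˡ-≤ ∣ p ∣ _ _ (subst (∣ p ∣ + _ ≤_) (sym (∣p∣+∣∁p∣≡n p)) h)

n≤∣p∣+k⇒∣∁p∣≤k : (p : Subset n) → n ≤ ∣ p ∣ + k → ∣ ∁ p ∣ ≤ k
n≤∣p∣+k⇒∣∁p∣≤k p h = +-cancelˡ-≤ ∣ p ∣ _ _ (subst (_≤ ∣ p ∣ + _) (sym (∣p∣+∣∁p∣≡n p)) h)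

k≤∣p∣⇒∣∁p∣+k≤n : (p : Subset n) → k ≤ ∣ p ∣ → ∣ ∁ p ∣ + k ≤ n
k≤∣p∣⇒∣∁p∣+k≤n p h = subst (∣ ∁ p ∣ + _ ≤_) (trans (+-comm _ ∣ p ∣) (∣p∣+∣∁p∣≡n p)) (+-monoʳ-≤ ∣ ∁ p ∣ h)

Y∈allSubsets : (Y : Subset n) → Y List.∈ allSubsets n
Y∈allSubsets []            = here refl
Y∈allSubsets (outside ∷ Y) = ∈-++⁺ˡ (∈-map⁺ (outside ∷_) (Y∈allSubsets Y))
Y∈allSubsets (inside  ∷ Y) = ∈-++⁺ʳ (map (outside ∷_) (allSubsets _)) (∈-map⁺ (inside ∷_) (Y∈allSubsets Y))

module FoldMax {a} {A : Set a} (c : A → Bool) (w : A → ℕ) (f : A → ℕ → ℕ)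
               (f-spec : ∀ x acc → f x acc ≡ (if c x then w x ⊔ acc else acc)) where

  foldr-max-≥ : ∀ {x} xs → x List.∈ xs → c x ≡ true → w x ≤ foldr f 0 xs
  foldr-max-≥ (x ∷ xs) (here refl) cx rewrite f-spec x (foldr f 0 xs) | cx = m≤m⊔n _ _
  foldr-max-≥ (z ∷ xs) (there x∈xs) cx rewrite f-spec z (foldr f 0 xs) with c z
  ... | true  = ≤-trans (foldr-max-≥ xs x∈xs cx) (m≤n⊔m _ _)
  ... | false = foldr-max-≥ xs x∈xs cx

  foldr-max-attained : ∀ xs → foldr f 0 xs ≡ 0 ⊎ ∃[ x ] (c x ≡ true × w x ≡ foldr f 0 xs)
  foldr-max-attained []       = inj₁ refl
  foldr-max-attained (z ∷ xs) rewrite f-spec z (foldr f 0 xs) with c z in cz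
  ... | false = foldr-max-attained xs
  ... | true with ⊔-sel (w z) (foldr f 0 xs)
  ...   | inj₁ ⊔≡w = inj₂ (z , cz , sym ⊔≡w)
  ...   | inj₂ ⊔≡acc rewrite ⊔≡acc = foldr-max-attained xs

-- `rank` folds a step function local to its where-block; unification recovers it.
rank-step : (M : Matroid n) (X : Subset n) → Σ (Subset n → ℕ → ℕ) λ f → rank M X ≡ foldr f 0 (allSubsets n)
rank-step M X = _ , refl

IsBasis : Matroid n → Subset n → Subset n → Set
IsBasis M X B = B ⊆ X × indep M B ≡ true × ∣ B ∣ ≡ rank M X

module _ (M : Matroid n) where

  private
    candidate : Subset n → Subset n → Bool
    candidate X Y = ⌊ Y ⊆? X ⌋ ∧ indep M Y

    rank-step-spec : ∀ X Y acc → proj₁ (rank-step M X) Y acc ≡ (if candidate X Y then ∣ Y ∣ ⊔ acc else acc)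
    rank-step-spec X Y acc with candidate X Y
    ... | true  = refl
    ... | false = refl

    module RankFold (X : Subset n) = FoldMax (candidate X) ∣_∣ (proj₁ (rank-step M X)) (rank-step-spec X)

  ∣I∣≤rank : ∀ {X I} → I ⊆ X → indep M I ≡ true → ∣ I ∣ ≤ rank M X
  ∣I∣≤rank {X} {I} I⊆X indI =
    RankFold.foldr-max-≥ X (allSubsets n) (Y∈allSubsets I)
      (subst (λ b → b ∧ indep M I ≡ true) (sym (trans (isYes≗does (I ⊆? X)) (dec-true (I ⊆? X) I⊆X))) indI)

  basis-exists : ∀ X → ∃[ B ] IsBasis M X B
  basis-exists X with RankFold.foldr-max-attained X (allSubsets n)
  ... | inj₁ rank≡0 = ∅ , ⊥⊆ , indep-∅ M , trans (∣⊥∣≡0 n) (sym rank≡0)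
  ... | inj₂ (B , cand , ∣B∣≡rank) with B ⊆? X | indep M B in indB
  ...   | yes B⊆X | true = B , B⊆X , indB , ∣B∣≡rank

  rank≤∣X∣ : ∀ X → rank M X ≤ ∣ X ∣
  rank≤∣X∣ X with B , B⊆X , _ , ∣B∣≡rank ← basis-exists X = subst (_≤ ∣ X ∣) ∣B∣≡rank (p⊆q⇒∣p∣≤∣q∣ B⊆X)

  rank-mono : ∀ {X Y} → X ⊆ Y → rank M X ≤ rank M Y
  rank-mono {X} X⊆Y with B , B⊆X , indB , ∣B∣≡rank ← basis-exists X =
    subst (_≤ _) ∣B∣≡rank (∣I∣≤rank (⊆-trans B⊆X X⊆Y) indB)

  rank-indep : ∀ {I} → indep M I ≡ true → rank M I ≡ ∣ I ∣
  rank-indep {I} indI = ≤-antisym (rank≤∣X∣ I) (∣I∣≤rank ⊆-refl indI)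

  rank-dep : ∀ {C} → indep M C ≡ false → rank M C < ∣ C ∣
  rank-dep {C} depC with B , B⊆C , indB , ∣B∣≡rank ← basis-exists C with B ⊂? C
  ... | yes B⊂C = subst (_< ∣ C ∣) ∣B∣≡rank (p⊂q⇒∣p∣<∣q∣ B⊂C)
  ... | no  B⊄C = contradiction (trans (sym (indep-⊆ M (p⊆q∧p⊄q⇒q⊆p B⊆C B⊄C) indB)) depC) λ ()

  rank-∪-≤ : ∀ X Y → rank M (X ∪ Y) ≤ rank M X + ∣ Y ∣
  rank-∪-≤ X Y with B , B⊆X∪Y , indB , ∣B∣≡rank ← basis-exists (X ∪ Y) = begin
    rank M (X ∪ Y)       ≡⟨ sym ∣B∣≡rank ⟩
    ∣ B ∣                ≤⟨ ∣p∣≤∣p─q∣+∣q∣ B Y ⟩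
    ∣ B ─ Y ∣ + ∣ Y ∣    ≤⟨ +-monoˡ-≤ ∣ Y ∣ (∣I∣≤rank B─Y⊆X (indep-⊆ M (p─q⊆p B Y) indB)) ⟩
    rank M X + ∣ Y ∣     ∎
    where
    open ≤-Reasoning
    B─Y⊆X : B ─ Y ⊆ X
    B─Y⊆X x∈B─Y = [ id , (λ x∈Y → contradiction x∈Y (x∈p─q⇒x∉q x∈B─Y)) ]′
                    (x∈p∪q⁻ X Y (B⊆X∪Y (p─q⊆p B Y x∈B─Y)))

  augment : ∀ {X I} → indep M I ≡ true → ∣ I ∣ < rank M X →
            ∃[ e ] (e ∈ X × e ∉ I × indep M (I ∪ ⁅ e ⁆) ≡ true)
  augment {X} indI ∣I∣<rank
    with B , B⊆X , indB , ∣B∣≡rank ← basis-exists X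
    with e , e∈B , e∉I , indI∪e ← indep-aug M indI indB (subst (_ <_) (sym ∣B∣≡rank) ∣I∣<rank)
    = e , B⊆X e∈B , e∉I , indI∪e

  basis-extends : ∀ {X I} → indep M I ≡ true → I ⊆ X → ∃[ B ] (I ⊆ B × IsBasis M X B)
  basis-extends {X} = extend (rank M X) (m≤m+n (rank M X) _)
    where
    extend : ∀ d {I} → rank M X ≤ d + ∣ I ∣ → indep M I ≡ true → I ⊆ X → ∃[ B ] (I ⊆ B × IsBasis M X B)
    extend d {I} rank≤ indI I⊆X with rank M X ≤? ∣ I ∣
    ... | yes rank≤∣I∣ = I , ⊆-refl , I⊆X , indI , ≤-antisym (∣I∣≤rank I⊆X indI) rank≤∣I∣
    extend zero    rank≤ indI I⊆X | no rank≰∣I∣ = contradiction rank≤ rank≰∣I∣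
    extend (suc d) {I} rank≤ indI I⊆X | no rank≰∣I∣ with augment indI (≰⇒> rank≰∣I∣)
    ... | e , e∈X , e∉I , indI∪e
      with B , I∪e⊆B , basis ← extend d
             (subst (rank M X ≤_) (trans (sym (+-suc d ∣ I ∣)) (cong (d +_) (sym (x∉p⇒∣p∪⁅x⁆∣≡1+∣p∣ e∉I)))) rank≤)
             indI∪e (p⊆r∧x∈r⇒p∪⁅x⁆⊆r I⊆X e∈X)
      = B , ⊆-trans (p⊆p∪q ⁅ e ⁆) I∪e⊆B , basis

InClosure : Matroid n → Fin n → Subset n → Set
InClosure M y Z = rank M (Z ∪ ⁅ y ⁆) ≤ rank M Z

module _ (M : Matroid n) where

  InClosure-mono : ∀ {y Z W} → Z ⊆ W → InClosure M y Z → InClosure M y W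
  InClosure-mono {y} {Z} {W} Z⊆W y∈clZ with y ∈? W
  ... | yes y∈W = rank-mono M (p⊆r∧x∈r⇒p∪⁅x⁆⊆r ⊆-refl y∈W)
  ... | no  y∉W
    with I , I⊆Z , indI , ∣I∣≡rank ← basis-exists M Z
    with B , I⊆B , B⊆W∪y , indB , ∣B∣≡rank ← basis-extends M indI (⊆-trans I⊆Z (⊆-trans Z⊆W (p⊆p∪q ⁅ y ⁆)))
    with y ∈? B
  ... | no y∉B = subst (_≤ rank M W) ∣B∣≡rank (∣I∣≤rank M B⊆W indB)
    where
    B⊆W : B ⊆ W
    B⊆W x∈B = [ id , (λ x∈⁅y⁆ → contradiction (subst (_∈ B) (x∈⁅y⁆⇒x≡y y x∈⁅y⁆) x∈B) y∉B) ]′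
                (x∈p∪q⁻ W ⁅ y ⁆ (B⊆W∪y x∈B))
  ... | yes y∈B = contradiction y∈clZ (<⇒≱ rankZ<)
    where
    rankZ< : rank M Z < rank M (Z ∪ ⁅ y ⁆)
    rankZ< = subst (_≤ rank M (Z ∪ ⁅ y ⁆))
      (trans (x∉p⇒∣p∪⁅x⁆∣≡1+∣p∣ (y∉W ∘ Z⊆W ∘ I⊆Z)) (cong suc ∣I∣≡rank))
      (∣I∣≤rank M (p⊆r∧x∈r⇒p∪⁅x⁆⊆r (⊆-trans I⊆Z (p⊆p∪q ⁅ y ⁆)) (q⊆p∪q Z ⁅ y ⁆ (x∈⁅x⁆ y)))
                  (indep-⊆ M (p⊆r∧x∈r⇒p∪⁅x⁆⊆r I⊆B y∈B) indB))

  circuit-rank : ∀ {C y} → IsCircuit M C → y ∈ C → suc (rank M C) ≡ ∣ C ∣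
  circuit-rank {C} {y} (depC , minimal) y∈C = ≤-antisym (rank-dep M depC) (begin
    ∣ C ∣                 ≡⟨ sym (x∈p⇒∣p-x∣+1≡∣p∣ y∈C) ⟩
    suc ∣ C - y ∣         ≡⟨ cong suc (sym (rank-indep M (minimal (C - y) (x∈p⇒p-x⊂p y∈C)))) ⟩
    suc (rank M (C - y))  ≤⟨ s≤s (rank-mono M (p─q⊆p C ⁅ y ⁆)) ⟩
    suc (rank M C)        ∎)
    where open ≤-Reasoning

  circuit-InClosure : ∀ {C y} → IsCircuit M C → y ∈ C → InClosure M y (C - y)
  circuit-InClosure {C} {y} circuit@(_ , minimal) y∈C = begin
    rank M ((C - y) ∪ ⁅ y ⁆) ≤⟨ rank-mono M (p⊆r∧x∈r⇒p∪⁅x⁆⊆r (p─q⊆p C ⁅ y ⁆) y∈C) ⟩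
    rank M C               ≡⟨ suc-injective (trans (circuit-rank circuit y∈C) (sym (x∈p⇒∣p-x∣+1≡∣p∣ y∈C))) ⟩
    ∣ C - y ∣              ≡⟨ sym (rank-indep M (minimal (C - y) (x∈p⇒p-x⊂p y∈C))) ⟩
    rank M (C - y)         ∎
    where open ≤-Reasoning

  cocircuit-¬InClosure : ∀ {C x} → IsCocircuit M C → x ∈ C → ¬ InClosure M x (∁ C)
  cocircuit-¬InClosure {C} {x} (rank∁C<rank , minimal) x∈C x∈cl∁C = <-irrefl refl (begin-strict
    rank M ⊤                ≡⟨ sym (minimal (C - x) (x∈p⇒p-x⊂p x∈C)) ⟩
    rank M (∁ (C - x))      ≤⟨ rank-mono M (∁[p-x]⊆∁p∪⁅x⁆ x) ⟩
    rank M (∁ C ∪ ⁅ x ⁆)    ≤⟨ x∈cl∁C ⟩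
    rank M (∁ C)            <⟨ rank∁C<rank ⟩
    rank M ⊤                ∎)
    where open ≤-Reasoning

module Arms {m} (arm : Fin n → Fin m) (arm-size : ∀ i → ∣ armUnion arm ⁅ i ⁆ ∣ ≡ 2) where

  A : Subset m → Subset n
  A = armUnion arm

  ∈A⁻ : ∀ {e} J → e ∈ A J → arm e ∈ J
  ∈A⁻ {e} J e∈AJ = lookup⇒[]= (arm e) J (trans (sym (lookup∘tabulate (lookup J ∘ arm) e)) ([]=⇒lookup e∈AJ))

  ∈A⁺ : ∀ {e} J → arm e ∈ J → e ∈ A J
  ∈A⁺ {e} J arme∈J = lookup⇒[]= e (A J) (trans (lookup∘tabulate (lookup J ∘ arm) e) ([]=⇒lookup arme∈J))

  A-mono : ∀ {J K} → J ⊆ K → A J ⊆ A K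
  A-mono {J} {K} J⊆K = ∈A⁺ K ∘ J⊆K ∘ ∈A⁻ J

  A-∁ : ∀ J → A (∁ J) ≡ ∁ (A J)
  A-∁ J = trans (tabulate-cong (λ e → lookup-map (arm e) not J)) (tabulate-∘ not (lookup J ∘ arm))

  ∈A⁅i⁆⇒arm≡i : ∀ {e} i → e ∈ A ⁅ i ⁆ → arm e ≡ i
  ∈A⁅i⁆⇒arm≡i i = x∈⁅y⁆⇒x≡y i ∘ ∈A⁻ ⁅ i ⁆

  A⁅i⁆⊆A : ∀ {i J} → i ∈ J → A ⁅ i ⁆ ⊆ A J
  A⁅i⁆⊆A {i} {J} i∈J e∈A⁅i⁆ = ∈A⁺ J (subst (_∈ J) (sym (∈A⁅i⁆⇒arm≡i i e∈A⁅i⁆)) i∈J)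

  A⊆A[J-i]∪A⁅i⁆ : ∀ i J → A J ⊆ A (J - i) ∪ A ⁅ i ⁆
  A⊆A[J-i]∪A⁅i⁆ i J {e} e∈AJ with arm e ≟ᶠ i
  ... | yes arme≡i = q⊆p∪q (A (J - i)) (A ⁅ i ⁆) (∈A⁺ ⁅ i ⁆ (subst (_∈ ⁅ i ⁆) (sym arme≡i) (x∈⁅x⁆ i)))
  ... | no  arme≢i = p⊆p∪q (A ⁅ i ⁆) (∈A⁺ (J - i) (x∈p∧x≢y⇒x∈p-y (∈A⁻ J e∈AJ) arme≢i))

  arm-element : ∀ i → Nonempty (A ⁅ i ⁆)
  arm-element i = ∣p∣≡1+k⇒Nonempty (A ⁅ i ⁆) (arm-size i)

  ∣A⁅i⁆-e∣≡1 : ∀ {e} i → e ∈ A ⁅ i ⁆ → ∣ A ⁅ i ⁆ - e ∣ ≡ 1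
  ∣A⁅i⁆-e∣≡1 i e∈A⁅i⁆ = ∣p∣≡1+k⇒∣p-x∣≡k e∈A⁅i⁆ (arm-size i)

  A-⊂ : ∀ {J K} → J ⊂ K → A J ⊂ A K
  A-⊂ {J} {K} (J⊆K , i , i∈K , i∉J) with e , e∈A⁅i⁆ ← arm-element i =
    A-mono J⊆K , e , A⁅i⁆⊆A i∈K e∈A⁅i⁆ , λ e∈AJ → i∉J (subst (_∈ J) (∈A⁅i⁆⇒arm≡i i e∈A⁅i⁆) (∈A⁻ J e∈AJ))

  ∣A∣≡2*∣J∣ : ∀ J → ∣ A J ∣ ≡ 2 * ∣ J ∣
  ∣A∣≡2*∣J∣ J = count ∣ J ∣ J refl
    where
    count : ∀ k J → ∣ J ∣ ≡ k → ∣ A J ∣ ≡ 2 * k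
    count zero J ∣J∣≡0 = n≤0⇒n≡0 (≤-trans (p⊆q⇒∣p∣≤∣q∣ AJ⊆∅) (≤-reflexive (∣⊥∣≡0 n)))
      where
      AJ⊆∅ : A J ⊆ ∅
      AJ⊆∅ e∈AJ = contradiction (sym ∣J∣≡0) (<⇒≢ (Nonempty⇒0<∣p∣ (_ , ∈A⁻ J e∈AJ)))
    count (suc k) J ∣J∣≡1+k with i , i∈J ← ∣p∣≡1+k⇒Nonempty J ∣J∣≡1+k = begin
      ∣ A J ∣                          ≡⟨ cong ∣_∣ AJ≡ ⟩
      ∣ A (J - i) ∪ A ⁅ i ⁆ ∣          ≡⟨ ∣p∪q∣≡∣p∣+∣q∣ (A (J - i)) (A ⁅ i ⁆) disjoint ⟩
      ∣ A (J - i) ∣ + ∣ A ⁅ i ⁆ ∣      ≡⟨ cong₂ _+_ (count k (J - i) (∣p∣≡1+k⇒∣p-x∣≡k i∈J ∣J∣≡1+k)) (arm-size i) ⟩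
      2 * k + 2                       ≡⟨ +-comm (2 * k) 2 ⟩
      2 + 2 * k                       ≡⟨ *-suc 2 k ⟨
      2 * suc k                       ∎
      where
      open ≡-Reasoning
      disjoint : ∀ {e} → e ∈ A (J - i) → e ∉ A ⁅ i ⁆
      disjoint e∈A[J-i] e∈A⁅i⁆ = x∉p-x (subst (_∈ J - i) (∈A⁅i⁆⇒arm≡i i e∈A⁅i⁆) (∈A⁻ (J - i) e∈A[J-i]))
      AJ≡ : A J ≡ A (J - i) ∪ A ⁅ i ⁆
      AJ≡ = ⊆-antisym (A⊆A[J-i]∪A⁅i⁆ i J) (λ e∈ → [ A-mono (p─q⊆p J ⁅ i ⁆) , A⁅i⁆⊆A i∈J ]′ (x∈p∪q⁻ _ _ e∈))

module Spike {s′ t′ m} (M : Matroid n) (arm : Fin n → Fin m) (spike : IsSpike (suc s′) (suc t′) m M arm) where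

  open IsSpike spike
  open Arms arm arm-size

  rank-A-few : ∀ J → ∣ J ∣ ≤ s′ → rank M (A J) ≡ 2 * ∣ J ∣
  rank-A-few J ∣J∣≤s′ with K , J⊂K , ∣K∣≡s ← proper-superset-of-size J (s≤s ∣J∣≤s′) s≤m =
    trans (rank-indep M (proj₂ (circuits K ∣K∣≡s) (A J) (A-⊂ J⊂K))) (∣A∣≡2*∣J∣ J)

  rank-∁A-few : ∀ J → ∣ J ∣ ≤ t′ → rank M (∁ (A J)) ≡ rank M ⊤
  rank-∁A-few J ∣J∣≤t′ with K , J⊂K , ∣K∣≡t ← proper-superset-of-size J (s≤s ∣J∣≤t′) t≤m =
    proj₂ (cocircuits K ∣K∣≡t) (A J) (A-⊂ J⊂K)

  rank-A-cofew : ∀ J → ∣ ∁ J ∣ ≤ t′ → rank M (A J) ≡ rank M ⊤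
  rank-A-cofew J ∣∁J∣≤t′ =
    subst (λ X → rank M X ≡ rank M ⊤) (trans (cong ∁ (A-∁ J)) (∁-involutive (A J))) (rank-∁A-few (∁ J) ∣∁J∣≤t′)

  rank-A-step≤ : ∀ {i J} → i ∈ J → s′ ≤ ∣ J - i ∣ → rank M (A J) ≤ suc (rank M (A (J - i)))
  rank-A-step≤ {i} {J} i∈J s′≤∣J-i∣
    with S₀ , S₀⊆J-i , ∣S₀∣≡s′ ← subset-of-size (J - i) s′≤∣J-i∣
    with y , y∈A⁅i⁆ ← arm-element i = begin
    rank M (A J)                         ≤⟨ rank-mono M (p⊆p-x∪⁅x⁆ y) ⟩
    rank M ((A J - y) ∪ ⁅ y ⁆)           ≤⟨ InClosure-mono M (p⊆q⇒p-x⊆q-x (A-mono S⊆J)) y∈cl[AS-y] ⟩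
    rank M (A J - y)                     ≤⟨ rank-mono M AJ-y⊆ ⟩
    rank M (A (J - i) ∪ (A ⁅ i ⁆ - y))   ≤⟨ rank-∪-≤ M (A (J - i)) (A ⁅ i ⁆ - y) ⟩
    rank M (A (J - i)) + ∣ A ⁅ i ⁆ - y ∣ ≡⟨ cong (rank M (A (J - i)) +_) (∣A⁅i⁆-e∣≡1 i y∈A⁅i⁆) ⟩
    rank M (A (J - i)) + 1               ≡⟨ +-comm _ 1 ⟩
    suc (rank M (A (J - i)))             ∎
    where
    open ≤-Reasoning
    S : Subset m
    S = S₀ ∪ ⁅ i ⁆
    S⊆J : S ⊆ J
    S⊆J = p⊆r∧x∈r⇒p∪⁅x⁆⊆r (⊆-trans S₀⊆J-i (p─q⊆p J ⁅ i ⁆)) i∈J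
    ∣S∣≡s : ∣ S ∣ ≡ suc s′
    ∣S∣≡s = trans (x∉p⇒∣p∪⁅x⁆∣≡1+∣p∣ (x∉p-x ∘ S₀⊆J-i)) (cong suc ∣S₀∣≡s′)
    y∈cl[AS-y] : InClosure M y (A S - y)
    y∈cl[AS-y] = circuit-InClosure M (circuits S ∣S∣≡s) (A⁅i⁆⊆A (q⊆p∪q S₀ ⁅ i ⁆ (x∈⁅x⁆ i)) y∈A⁅i⁆)
    AJ-y⊆ : A J - y ⊆ A (J - i) ∪ (A ⁅ i ⁆ - y)
    AJ-y⊆ {e} e∈AJ-y with x∈p∪q⁻ _ _ (A⊆A[J-i]∪A⁅i⁆ i J (p─q⊆p (A J) ⁅ y ⁆ e∈AJ-y))
    ... | inj₁ e∈A[J-i] = p⊆p∪q (A ⁅ i ⁆ - y) e∈A[J-i]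
    ... | inj₂ e∈A⁅i⁆   = q⊆p∪q (A (J - i)) (A ⁅ i ⁆ - y) (x∈p∧x∉q⇒x∈p─q e∈A⁅i⁆ (x∈p─q⇒x∉q e∈AJ-y))

  rank-A-step≥ : ∀ {i J} → i ∈ J → ∣ J ∣ + t′ ≤ m → suc (rank M (A (J - i))) ≤ rank M (A J)
  rank-A-step≥ {i} {J} i∈J ∣J∣+t′≤m
    with T , T⊆∁J , ∣T∣≡t′ ← subset-of-size (∁ J) (∣p∣+k≤n⇒k≤∣∁p∣ J ∣J∣+t′≤m)
    with x , x∈A⁅i⁆ ← arm-element i = begin
    suc (rank M (A (J - i)))      ≤⟨ ≰⇒> x∉cl[A[J-i]] ⟩
    rank M (A (J - i) ∪ ⁅ x ⁆)    ≤⟨ rank-mono M (p⊆r∧x∈r⇒p∪⁅x⁆⊆r (A-mono (p─q⊆p J ⁅ i ⁆)) (A⁅i⁆⊆A i∈J x∈A⁅i⁆)) ⟩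
    rank M (A J)                  ∎
    where
    open ≤-Reasoning
    K : Subset m
    K = T ∪ ⁅ i ⁆
    ∣K∣≡t : ∣ K ∣ ≡ suc t′
    ∣K∣≡t = trans (x∉p⇒∣p∪⁅x⁆∣≡1+∣p∣ (λ i∈T → x∈∁p⇒x∉p (T⊆∁J i∈T) i∈J)) (cong suc ∣T∣≡t′)
    A[J-i]⊆∁AK : A (J - i) ⊆ ∁ (A K)
    A[J-i]⊆∁AK {e} e∈A[J-i] = x∉p⇒x∈∁p λ e∈AK →
      [ (λ arme∈T → x∈∁p⇒x∉p (T⊆∁J arme∈T) (p─q⊆p J ⁅ i ⁆ arme∈J-i))
      , (λ arme∈⁅i⁆ → x∉p-x (subst (_∈ J - i) (x∈⁅y⁆⇒x≡y i arme∈⁅i⁆) arme∈J-i))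
      ]′ (x∈p∪q⁻ T ⁅ i ⁆ (∈A⁻ K e∈AK))
      where
      arme∈J-i : arm e ∈ J - i
      arme∈J-i = ∈A⁻ (J - i) e∈A[J-i]
    x∉cl[A[J-i]] : ¬ InClosure M x (A (J - i))
    x∉cl[A[J-i]] = cocircuit-¬InClosure M (cocircuits K ∣K∣≡t) (A⁅i⁆⊆A (q⊆p∪q T ⁅ i ⁆ (x∈⁅x⁆ i)) x∈A⁅i⁆)
                 ∘ InClosure-mono M A[J-i]⊆∁AK

  rank-A-many : ∀ J → s′ ≤ ∣ J ∣ → ∣ J ∣ + t′ ≤ m → rank M (A J) ≡ ∣ J ∣ + s′
  rank-A-many J s′≤∣J∣ = go (∣ J ∣ ∸ s′) J (sym (m∸n+n≡m s′≤∣J∣))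
    where
    go : ∀ d J → ∣ J ∣ ≡ d + s′ → ∣ J ∣ + t′ ≤ m → rank M (A J) ≡ ∣ J ∣ + s′
    go zero J ∣J∣≡s′ _ = begin
      rank M (A J)  ≡⟨ rank-A-few J (≤-reflexive ∣J∣≡s′) ⟩
      2 * ∣ J ∣     ≡⟨ cong (∣ J ∣ +_) (trans (+-identityʳ ∣ J ∣) ∣J∣≡s′) ⟩
      ∣ J ∣ + s′    ∎
      where open ≡-Reasoning
    go (suc d) J ∣J∣≡1+d+s′ ∣J∣+t′≤m with i , i∈J ← ∣p∣≡1+k⇒Nonempty J ∣J∣≡1+d+s′ =
      ≤-antisym (subst (rank M (A J) ≤_) 1+rank≡ (rank-A-step≤ i∈J s′≤∣J-i∣))
                (subst (_≤ rank M (A J)) 1+rank≡ (rank-A-step≥ i∈J ∣J∣+t′≤m))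
      where
      ∣J-i∣≡d+s′ : ∣ J - i ∣ ≡ d + s′
      ∣J-i∣≡d+s′ = ∣p∣≡1+k⇒∣p-x∣≡k i∈J ∣J∣≡1+d+s′
      s′≤∣J-i∣ : s′ ≤ ∣ J - i ∣
      s′≤∣J-i∣ = subst (s′ ≤_) (sym ∣J-i∣≡d+s′) (m≤n+m s′ d)
      ∣J-i∣+t′≤m : ∣ J - i ∣ + t′ ≤ m
      ∣J-i∣+t′≤m = ≤-trans (+-monoˡ-≤ t′ (∣p─q∣≤∣p∣ J ⁅ i ⁆)) ∣J∣+t′≤m
      1+rank≡ : suc (rank M (A (J - i))) ≡ ∣ J ∣ + s′
      1+rank≡ = begin
        suc (rank M (A (J - i)))  ≡⟨ cong suc (go d (J - i) ∣J-i∣≡d+s′ ∣J-i∣+t′≤m) ⟩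
        suc (∣ J - i ∣ + s′)      ≡⟨ cong (_+ s′) (x∈p⇒∣p-x∣+1≡∣p∣ i∈J) ⟩
        ∣ J ∣ + s′                ∎
        where open ≡-Reasoning

  s′+t′<m : s′ + t′ < m
  s′+t′<m with s′ + t′ <? m
  ... | yes s′+t′<m = s′+t′<m
  ... | no  s′+t′≮m
    with S , _ , ∣S∣≡s ← subset-of-size ⊤ (subst (suc s′ ≤_) (sym (∣⊤∣≡n m)) s≤m)
    with i , i∈S ← ∣p∣≡1+k⇒Nonempty S ∣S∣≡s
    with y , y∈A⁅i⁆ ← arm-element i = contradiction (suc-injective 2+2s′≡1+2s′) 1+n≢n
    where
    m≤s′+t′ : m ≤ s′ + t′
    m≤s′+t′ = ≮⇒≥ s′+t′≮m
    ∣S-i∣≡s′ : ∣ S - i ∣ ≡ s′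
    ∣S-i∣≡s′ = ∣p∣≡1+k⇒∣p-x∣≡k i∈S ∣S∣≡s
    rank-AS≡rank-A[S-i] : rank M (A S) ≡ rank M (A (S - i))
    rank-AS≡rank-A[S-i] = trans
      (rank-A-cofew S (n≤∣p∣+k⇒∣∁p∣≤k S (subst (λ z → m ≤ z + t′) (sym ∣S∣≡s) (≤-trans m≤s′+t′ (n≤1+n _)))))
      (sym (rank-A-cofew (S - i) (n≤∣p∣+k⇒∣∁p∣≤k (S - i) (subst (λ z → m ≤ z + t′) (sym ∣S-i∣≡s′) m≤s′+t′))))
    2+2s′≡1+2s′ : 2 + 2 * s′ ≡ suc (2 * s′)
    2+2s′≡1+2s′ = begin
      2 + 2 * s′                ≡⟨ *-suc 2 s′ ⟨
      2 * suc s′                ≡⟨ cong (2 *_) ∣S∣≡s ⟨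
      2 * ∣ S ∣                 ≡⟨ ∣A∣≡2*∣J∣ S ⟨
      ∣ A S ∣                   ≡⟨ circuit-rank M (circuits S ∣S∣≡s) (A⁅i⁆⊆A i∈S y∈A⁅i⁆) ⟨
      suc (rank M (A S))        ≡⟨ cong suc rank-AS≡rank-A[S-i] ⟩
      suc (rank M (A (S - i)))  ≡⟨ cong suc (rank-A-few (S - i) (≤-reflexive ∣S-i∣≡s′)) ⟩
      suc (2 * ∣ S - i ∣)       ≡⟨ cong (λ k → suc (2 * k)) ∣S-i∣≡s′ ⟩
      suc (2 * s′)              ∎
      where open ≡-Reasoning

  rank-⊤ : rank M ⊤ + t′ ≡ m + s′
  rank-⊤ with J , _ , ∣J∣≡m∸t′ ← subset-of-size ⊤ (subst (m ∸ t′ ≤_) (sym (∣⊤∣≡n m)) (m∸n≤m m t′)) = begin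
    rank M ⊤ + t′        ≡⟨ cong (_+ t′) (rank-A-cofew J ∣∁J∣≤t′) ⟨
    rank M (A J) + t′    ≡⟨ cong (_+ t′) (rank-A-many J s′≤∣J∣ (≤-reflexive ∣J∣+t′≡m)) ⟩
    ∣ J ∣ + s′ + t′       ≡⟨ +-assoc ∣ J ∣ s′ t′ ⟩
    ∣ J ∣ + (s′ + t′)     ≡⟨ cong (∣ J ∣ +_) (+-comm s′ t′) ⟩
    ∣ J ∣ + (t′ + s′)     ≡⟨ +-assoc ∣ J ∣ t′ s′ ⟨
    ∣ J ∣ + t′ + s′       ≡⟨ cong (_+ s′) ∣J∣+t′≡m ⟩
    m + s′               ∎
    where
    open ≡-Reasoning
    ∣J∣+t′≡m : ∣ J ∣ + t′ ≡ m
    ∣J∣+t′≡m = trans (cong (_+ t′) ∣J∣≡m∸t′) (m∸n+n≡m (≤-trans (n≤1+n t′) t≤m))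
    ∣∁J∣≤t′ : ∣ ∁ J ∣ ≤ t′
    ∣∁J∣≤t′ = n≤∣p∣+k⇒∣∁p∣≤k J (≤-reflexive (sym ∣J∣+t′≡m))
    s′≤∣J∣ : s′ ≤ ∣ J ∣
    s′≤∣J∣ = +-cancelʳ-≤ t′ s′ ∣ J ∣ (subst (s′ + t′ ≤_) (sym ∣J∣+t′≡m) (<⇒≤ s′+t′<m))

  -- t′ is added on both sides so that r(M) = m − t′ + s′ enters without truncated subtraction.
  conn-A-from-ranks : ∀ J X → rank M (A J) + rank M (A (∁ J)) + t′ ≡ X + (m + s′) → conn M (A J) ≡ X
  conn-A-from-ranks J X eq = begin
    rank M (A J) + rank M (∁ (A J)) ∸ rank M ⊤  ≡⟨ cong (λ Y → rank M (A J) + rank M Y ∸ rank M ⊤) (A-∁ J) ⟨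
    rank M (A J) + rank M (A (∁ J)) ∸ rank M ⊤  ≡⟨ cong (_∸ rank M ⊤) ranks≡X+rank-⊤ ⟩
    X + rank M ⊤ ∸ rank M ⊤                     ≡⟨ m+n∸n≡m X (rank M ⊤) ⟩
    X                                           ∎
    where
    open ≡-Reasoning
    ranks≡X+rank-⊤ : rank M (A J) + rank M (A (∁ J)) ≡ X + rank M ⊤
    ranks≡X+rank-⊤ = +-cancelʳ-≡ t′ _ _
      (trans eq (trans (cong (X +_) (sym rank-⊤)) (sym (+-assoc X (rank M ⊤) t′))))

  conn-A-few : ∀ J → ∣ J ∣ ≤ t′ → conn M (A J) ≡ rank M (A J)
  conn-A-few J ∣J∣≤t′ =
    trans (cong (λ b → rank M (A J) + b ∸ rank M ⊤) (rank-∁A-few J ∣J∣≤t′)) (m+n∸n≡m (rank M (A J)) (rank M ⊤))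

  conn-A-middle-few : ∀ J → t′ ≤ ∣ J ∣ → ∣ J ∣ + suc s′ ≤ m → ∣ J ∣ ≤ s′ → conn M (A J) ≡ t′ + ∣ J ∣
  conn-A-middle-few J t′≤∣J∣ ∣J∣+s≤m ∣J∣≤s′ = conn-A-from-ranks J (t′ + ∣ J ∣) (begin
    rank M (A J) + rank M (A (∁ J)) + t′      ≡⟨ cong₂ (λ a b → a + b + t′) rank-AJ rank-A∁J ⟩
    2 * ∣ J ∣ + (∣ ∁ J ∣ + s′) + t′           ≡⟨ rearrange ∣ J ∣ ∣ ∁ J ∣ s′ t′ ⟩
    t′ + ∣ J ∣ + (∣ J ∣ + ∣ ∁ J ∣ + s′)       ≡⟨ cong (λ z → t′ + ∣ J ∣ + (z + s′)) (∣p∣+∣∁p∣≡n J) ⟩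
    t′ + ∣ J ∣ + (m + s′)                     ∎)
    where
    open ≡-Reasoning
    rank-AJ : rank M (A J) ≡ 2 * ∣ J ∣
    rank-AJ = rank-A-few J ∣J∣≤s′
    rank-A∁J : rank M (A (∁ J)) ≡ ∣ ∁ J ∣ + s′
    rank-A∁J = rank-A-many (∁ J) (≤-trans (n≤1+n s′) (∣p∣+k≤n⇒k≤∣∁p∣ J ∣J∣+s≤m)) (k≤∣p∣⇒∣∁p∣+k≤n J t′≤∣J∣)
    rearrange : ∀ j k s t → 2 * j + (k + s) + t ≡ t + j + (j + k + s)
    rearrange = solve-∀

  conn-A-middle-many : ∀ J → ∣ J ∣ ≤ ∣ ∁ J ∣ → t′ ≤ ∣ J ∣ → s′ ≤ ∣ J ∣ → ∣ J ∣ + t′ ≤ m →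
                       conn M (A J) ≡ s′ + t′
  conn-A-middle-many J ∣J∣≤∣∁J∣ t′≤∣J∣ s′≤∣J∣ ∣J∣+t′≤m = conn-A-from-ranks J (s′ + t′) (begin
    rank M (A J) + rank M (A (∁ J)) + t′      ≡⟨ cong₂ (λ a b → a + b + t′) rank-AJ rank-A∁J ⟩
    ∣ J ∣ + s′ + (∣ ∁ J ∣ + s′) + t′          ≡⟨ rearrange ∣ J ∣ ∣ ∁ J ∣ s′ t′ ⟩
    s′ + t′ + (∣ J ∣ + ∣ ∁ J ∣ + s′)          ≡⟨ cong (λ z → s′ + t′ + (z + s′)) (∣p∣+∣∁p∣≡n J) ⟩
    s′ + t′ + (m + s′)                        ∎)
    where
    open ≡-Reasoning
    rank-AJ : rank M (A J) ≡ ∣ J ∣ + s′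
    rank-AJ = rank-A-many J s′≤∣J∣ ∣J∣+t′≤m
    rank-A∁J : rank M (A (∁ J)) ≡ ∣ ∁ J ∣ + s′
    rank-A∁J = rank-A-many (∁ J) (≤-trans s′≤∣J∣ ∣J∣≤∣∁J∣) (k≤∣p∣⇒∣∁p∣+k≤n J t′≤∣J∣)
    rearrange : ∀ j k s t → j + s + (k + s) + t ≡ s + t + (j + k + s)
    rearrange = solve-∀

  conn-A-many : ∀ J → ∣ J ∣ ≤ ∣ ∁ J ∣ → m ≤ ∣ J ∣ + s′ → conn M (A J) ≡ m ∸ suc s′ + suc t′
  conn-A-many J ∣J∣≤∣∁J∣ m≤∣J∣+s′ = conn-A-from-ranks J (w + suc t′) (begin
    rank M (A J) + rank M (A (∁ J)) + t′      ≡⟨ cong₂ (λ a b → a + b + t′) rank-AJ rank-A∁J ⟩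
    2 * ∣ J ∣ + 2 * ∣ ∁ J ∣ + t′               ≡⟨ rearrange₁ ∣ J ∣ ∣ ∁ J ∣ t′ ⟩
    (∣ J ∣ + ∣ ∁ J ∣) + (∣ J ∣ + ∣ ∁ J ∣) + t′ ≡⟨ cong (λ z → z + z + t′) (∣p∣+∣∁p∣≡n J) ⟩
    m + m + t′                                ≡⟨ cong (λ z → z + m + t′) (m∸n+n≡m s≤m) ⟨
    w + suc s′ + m + t′                       ≡⟨ rearrange₂ w s′ m t′ ⟩
    w + suc t′ + (m + s′)                     ∎)
    where
    open ≡-Reasoning
    w : ℕ
    w = m ∸ suc s′
    ∣∁J∣≤s′ : ∣ ∁ J ∣ ≤ s′
    ∣∁J∣≤s′ = n≤∣p∣+k⇒∣∁p∣≤k J m≤∣J∣+s′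
    rank-AJ : rank M (A J) ≡ 2 * ∣ J ∣
    rank-AJ = rank-A-few J (≤-trans ∣J∣≤∣∁J∣ ∣∁J∣≤s′)
    rank-A∁J : rank M (A (∁ J)) ≡ 2 * ∣ ∁ J ∣
    rank-A∁J = rank-A-few (∁ J) ∣∁J∣≤s′
    rearrange₁ : ∀ j k t → 2 * j + 2 * k + t ≡ (j + k) + (j + k) + t
    rearrange₁ = solve-∀
    rearrange₂ : ∀ w s m t → w + suc s + m + t ≡ w + suc t + (m + s)
    rearrange₂ = solve-∀

lemma5p5 : (s t m n : ℕ) → 1 ≤ s → 1 ≤ t →
    (M : Matroid n) (arm : Fin n → Fin m) → IsSpike s t m M arm →
    (J : Subset m) → ∣ J ∣ ≤ ∣ ∁ J ∣ →
    ((∣ J ∣ ≤ t ∸ 1 → conn M (armUnion arm J) ≡ rank M (armUnion arm J))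
     × (t ∸ 1 ≤ ∣ J ∣ → ∣ J ∣ ≤ m ∸ s →
          (∣ J ∣ < s → conn M (armUnion arm J) ≡ t + ∣ J ∣ ∸ 1)
          × (s ≤ ∣ J ∣ → ∣ J ∣ ≤ m ∸ t + 1 → conn M (armUnion arm J) ≡ s + t ∸ 2))
     × (m ∸ s < ∣ J ∣ → conn M (armUnion arm J) ≡ m ∸ s + t))
lemma5p5 zero     _        _ _ () _  _ _   _     _ _
lemma5p5 (suc _)  zero     _ _ _  () _ _   _     _ _
lemma5p5 (suc s′) (suc t′) m n _  _  M arm spike J ∣J∣≤∣∁J∣ =
  conn-A-few J ,
  (λ t′≤∣J∣ ∣J∣≤m∸s →
     (λ ∣J∣<s → conn-A-middle-few J t′≤∣J∣ (m≤o∸n⇒m+n≤o ∣ J ∣ s≤m ∣J∣≤m∸s) (s≤s⁻¹ ∣J∣<s)) ,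
     (λ s≤∣J∣ ∣J∣≤m∸t+1 →
        trans (conn-A-middle-many J ∣J∣≤∣∁J∣ t′≤∣J∣ (≤-trans (n≤1+n s′) s≤∣J∣) (j≤m∸[1+n]+1⇒j+n≤m t≤m ∣J∣≤m∸t+1))
              (sym (cong (_∸ 1) (+-suc s′ t′))))) ,
  (λ m∸s<∣J∣ → conn-A-many J ∣J∣≤∣∁J∣ (m∸[1+n]<o⇒m≤o+n s≤m m∸s<∣J∣))
  where
  open Spike M arm spike
  open IsSpike spike using (s≤m; t≤m)
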